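{- For each fixed $h$, the function $n\mapsto M(n,h)=\frac{n+2-p_{min}(n+h)}{3}$ is non-decreasing in $n$.
   Context: A polyiamond is a finite union of closed tiles of the regular triangular lattice in the plane, any two meeting tiles sharing an entire edge, with connected interior. Its perimeter is the number of lattice edges on its topological boundary; $p_{min}(n)$ is the minimum perimeter among polyiamonds with $n$ tiles. -}

module Defs where

open import Data.Nat using (ℕ; zero; suc; _≤_)
import Data.Nat as ℕ
open import Data.Integer as ℤ using (ℤ; +_)
open import Data.Rational using (ℚ; _/_)
open import Data.Fin using (Fin; zero; suc)
open import Data.List using (List; []; _∷_; length; map)
open import Data.Nat.ListAction using (sum)
open import Data.List.Relation.Unary.Unique.Propositional using (Unique)
open import Data.List.Membership.Propositional using (_∈_)
open import Data.Product using (Σ; _×_)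
open import Relation.Nullary using (yes; no; does; ¬_)
open import Relation.Binary.Definitions using (DecidableEquality)
open import Relation.Binary.PropositionalEquality using (_≡_; refl)
open import Data.Bool using (if_then_else_)

-- Tiles of the regular triangular lattice.  Lattice points are a·e₁ + b·e₂
-- (a, b ∈ ℤ, e₁, e₂ unit vectors at 60°).  The tile (tile x y up) is the
-- triangle with vertices (x,y),(x+1,y),(x,y+1); the tile (tile x y down) is
-- the triangle with vertices (x+1,y),(x,y+1),(x+1,y+1).  Every tile is
-- exactly one of these.
data Orient : Set where
  up down : Orient

record Tile : Set where
  constructor tile
  field
    x : ℤ
    y : ℤ
    o : Orient

_≟O_ : DecidableEquality Orient
up ≟O up = yes refl
up ≟O down = no λ ()
down ≟O up = no λ ()
down ≟O down = yes refl

_≟T_ : DecidableEquality Tile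
tile x y o ≟T tile x' y' o' with x ℤ.≟ x' | y ℤ.≟ y' | o ≟O o'
... | yes refl | yes refl | yes refl = yes refl
... | no p | _ | _ = no λ { refl → p refl }
... | yes _ | no p | _ = no λ { refl → p refl }
... | yes _ | yes _ | no p = no λ { refl → p refl }

-- nbr t i : the unique tile sharing the i-th edge of t with t.
--   up (x,y):   edge 0 = (x+1,y)-(x,y+1), edge 1 = (x,y)-(x+1,y), edge 2 = (x,y)-(x,y+1)
--   down (x,y): edge 0 = (x+1,y)-(x,y+1), edge 1 = (x,y+1)-(x+1,y+1), edge 2 = (x+1,y)-(x+1,y+1)
nbr : Tile → Fin 3 → Tile
nbr (tile x y up) zero = tile x y down
nbr (tile x y up) (suc zero) = tile x (y ℤ.- + 1) down
nbr (tile x y up) (suc (suc zero)) = tile (x ℤ.- + 1) y down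
nbr (tile x y down) zero = tile x y up
nbr (tile x y down) (suc zero) = tile x (y ℤ.+ + 1) up
nbr (tile x y down) (suc (suc zero)) = tile (x ℤ.+ + 1) y up

member? : Tile → List Tile → Data.Bool.Bool
member? t [] = Data.Bool.false
member? t (u ∷ S) = if does (t ≟T u) then Data.Bool.true else member? t S

bndEdge : List Tile → Tile → Fin 3 → ℕ
bndEdge S t i = if member? (nbr t i) S then 0 else 1

bndTile : List Tile → Tile → ℕ
bndTile S t = bndEdge S t zero ℕ.+ bndEdge S t (suc zero) ℕ.+ bndEdge S t (suc (suc zero))

-- Perimeter: number of lattice edges lying in exactly one tile of S, i.e.
-- on the topological boundary of the union.  Each such edge is counted
-- once, from the unique tile of S containing it.
perimeter : List Tile → ℕ
perimeter S = sum (map (bndTile S) S)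

data Reach (S : List Tile) : Tile → Tile → Set where
  here : ∀ {t} → Reach S t t
  step : ∀ {t u} (i : Fin 3) → nbr t i ∈ S → Reach S (nbr t i) u → Reach S t u

-- A polyiamond, given by its (distinct, nonempty) list of tiles; its interior
-- is connected iff the tiles are connected through shared edges.
record IsPolyiamond (S : List Tile) : Set where
  field
    nonempty : ¬ (S ≡ [])
    distinct : Unique S
    connected : ∀ {t u} → t ∈ S → u ∈ S → Reach S t u

IsPMin : ℕ → ℕ → Set
IsPMin n p =
  Σ (List Tile) (λ S → IsPolyiamond S × length S ≡ n × perimeter S ≡ p)
  × (∀ S → IsPolyiamond S → length S ≡ n → p ≤ perimeter S)

-- M(n,h) = (n + 2 - p_min(n+h)) / 3, with p = p_min(n+h).
M : ℕ → ℕ → ℚ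
M n p = ((+ n ℤ.+ + 2) ℤ.- + p) / 3

-- Adding a tile to a polyiamond S raises the perimeter by at most one: take a
-- tile t of S that is maximal for a linear "level" function, and glue on the
-- tile u across the edge of t that leads one level up.  Then u is new, the
-- shared edge leaves the boundary of t, and u itself has at most two boundary
-- edges.  Hence p_min(k + d) ≤ p_min(k) + d, so n − p_min(n + h), and with
-- it M(n, h), does not decrease.
module Submission where

open import Defs
open import Data.Nat using (ℕ; _+_; _≤_)
import Data.Rational as ℚ

open import Data.Bool using (true; false)
open import Data.Empty using (⊥-elim)
open import Data.Fin using (Fin; zero; suc)
open import Data.Integer as ℤ using (ℤ; +_)
import Data.Integer.Properties as ℤ
open import Data.Integer.Tactic.RingSolver using (solve-∀)
open import Data.List using (List; []; _∷_; length; map)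
import Data.List.Extrema as Extrema
open import Data.List.Membership.Propositional using (_∈_; _∉_)
open import Data.List.Membership.DecPropositional _≟T_ using (_∈?_)
import Data.List.Relation.Unary.All as All
open import Data.List.Relation.Unary.All.Properties using (¬Any⇒All¬)
open import Data.List.Relation.Unary.AllPairs using (_∷_)
open import Data.List.Relation.Unary.Any using (here; there)
import Data.Nat as ℕ
open import Data.Nat.ListAction using (sum)
import Data.Nat.Properties as ℕ
open import Algebra.Properties.CommutativeSemigroup ℕ.+-commutativeSemigroup
  using (xy∙z≈xz∙y; x∙yz≈yx∙z)
import Data.Rational.Properties as ℚ
open import Data.Rational.Unnormalised as ℚᵘ using (mkℚᵘ; *≤*)
import Data.Rational.Unnormalised.Properties as ℚᵘ
open import Data.Product using (∃; _×_; _,_)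
open import Data.Sum using (inj₁; inj₂)
open import Relation.Nullary using (yes; no)
open import Relation.Binary.PropositionalEquality

i-1+1≡i : ∀ i → i ℤ.- + 1 ℤ.+ + 1 ≡ i
i-1+1≡i = solve-∀

i+1-1≡i : ∀ i → i ℤ.+ + 1 ℤ.- + 1 ≡ i
i+1-1≡i = solve-∀

nbr-involutive : ∀ t i → nbr (nbr t i) i ≡ t
nbr-involutive (tile x y up) zero = refl
nbr-involutive (tile x y up) (suc zero) = cong (λ y′ → tile x y′ up) (i-1+1≡i y)
nbr-involutive (tile x y up) (suc (suc zero)) = cong (λ x′ → tile x′ y up) (i-1+1≡i x)
nbr-involutive (tile x y down) zero = refl
nbr-involutive (tile x y down) (suc zero) = cong (λ y′ → tile x y′ down) (i+1-1≡i y)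
nbr-involutive (tile x y down) (suc (suc zero)) = cong (λ x′ → tile x′ y down) (i+1-1≡i x)

∈⇒member? : ∀ {t S} → t ∈ S → member? t S ≡ true
∈⇒member? {t} (here refl) with t ≟T t
... | yes _ = refl
... | no t≢t = ⊥-elim (t≢t refl)
∈⇒member? {t} {u ∷ _} (there t∈S) with t ≟T u
... | yes _ = refl
... | no _ = ∈⇒member? t∈S

member?⇒∈ : ∀ {t} S → member? t S ≡ true → t ∈ S
member?⇒∈ {t} (u ∷ S) eq with t ≟T u
... | yes refl = here refl
... | no _ = there (member?⇒∈ S eq)

∉⇒member? : ∀ {t} S → t ∉ S → member? t S ≡ false
∉⇒member? {t} S t∉S with member? t S in eq
... | true = ⊥-elim (t∉S (member?⇒∈ S eq))
... | false = refl

bndEdge≤1 : ∀ S t i → bndEdge S t i ≤ 1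
bndEdge≤1 S t i with member? (nbr t i) S
... | true = ℕ.z≤n
... | false = ℕ.≤-refl

bndEdge-∈ : ∀ {S} t i → nbr t i ∈ S → bndEdge S t i ≡ 0
bndEdge-∈ t i t∈S rewrite ∈⇒member? t∈S = refl

bndEdge-∉ : ∀ {S} t i → nbr t i ∉ S → bndEdge S t i ≡ 1
bndEdge-∉ {S} t i t∉S rewrite ∉⇒member? S t∉S = refl

bndEdge-∷-≤ : ∀ u S t i → bndEdge (u ∷ S) t i ≤ bndEdge S t i
bndEdge-∷-≤ u S t i with nbr t i ∈? S
... | yes t∈S rewrite bndEdge-∈ {u ∷ S} t i (there t∈S) = ℕ.z≤n
... | no t∉S rewrite bndEdge-∉ {S} t i t∉S = bndEdge≤1 (u ∷ S) t i

-- bndTile S t is definitionally sum3 (bndEdge S t).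
sum3 : (Fin 3 → ℕ) → ℕ
sum3 f = f zero + f (suc zero) + f (suc (suc zero))

sum3-mono-≤ : ∀ {f g : Fin 3 → ℕ} → (∀ j → f j ≤ g j) → sum3 f ≤ sum3 g
sum3-mono-≤ f≤g = ℕ.+-mono-≤ (ℕ.+-mono-≤ (f≤g _) (f≤g _)) (f≤g _)

sum3-mono-< : ∀ {f g : Fin 3 → ℕ} → (∀ j → f j ≤ g j) → ∀ i → f i ℕ.< g i → sum3 f ℕ.< sum3 g
sum3-mono-< f≤g zero lt = ℕ.+-mono-<-≤ (ℕ.+-mono-<-≤ lt (f≤g _)) (f≤g _)
sum3-mono-< f≤g (suc zero) lt = ℕ.+-mono-<-≤ (ℕ.+-mono-≤-< (f≤g _) lt) (f≤g _)
sum3-mono-< f≤g (suc (suc zero)) lt = ℕ.+-mono-≤-< (ℕ.+-mono-≤ (f≤g _) (f≤g _)) lt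

sum3≤2 : ∀ {f : Fin 3 → ℕ} → (∀ j → f j ≤ 1) → ∀ i → f i ≡ 0 → sum3 f ≤ 2
sum3≤2 {f} f≤1 zero eq rewrite eq = ℕ.+-mono-≤ (f≤1 _) (f≤1 _)
sum3≤2 {f} f≤1 (suc zero) eq rewrite eq = ℕ.+-mono-≤ (ℕ.+-mono-≤ (f≤1 _) (ℕ.z≤n {0})) (f≤1 _)
sum3≤2 {f} f≤1 (suc (suc zero)) eq rewrite eq = ℕ.+-mono-≤ (ℕ.+-mono-≤ (f≤1 _) (f≤1 _)) ℕ.z≤n

bndTile-∷-≤ : ∀ u S t → bndTile (u ∷ S) t ≤ bndTile S t
bndTile-∷-≤ u S t = sum3-mono-≤ (bndEdge-∷-≤ u S t)

bndTile-∷-< : ∀ {S t} i → nbr t i ∉ S → bndTile (nbr t i ∷ S) t ℕ.< bndTile S t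
bndTile-∷-< {S} {t} i new∉S = sum3-mono-< (bndEdge-∷-≤ (nbr t i) S t) i
  (subst₂ ℕ._<_ (sym (bndEdge-∈ {nbr t i ∷ S} t i (here refl))) (sym (bndEdge-∉ {S} t i new∉S)) ℕ.z<s)

bndTile≤2 : ∀ {S} t i → nbr t i ∈ S → bndTile S t ≤ 2
bndTile≤2 {S} t i t∈S = sum3≤2 (bndEdge≤1 S t) i (bndEdge-∈ t i t∈S)

module _ {A : Set} where

  sum-map-mono-≤ : ∀ {f g : A → ℕ} → (∀ x → f x ≤ g x) → ∀ xs → sum (map f xs) ≤ sum (map g xs)
  sum-map-mono-≤ f≤g [] = ℕ.z≤n
  sum-map-mono-≤ f≤g (x ∷ xs) = ℕ.+-mono-≤ (f≤g x) (sum-map-mono-≤ f≤g xs)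

  sum-map-mono-< : ∀ {f g : A → ℕ} → (∀ x → f x ≤ g x) → ∀ {y xs} → y ∈ xs → f y ℕ.< g y →
                   sum (map f xs) ℕ.< sum (map g xs)
  sum-map-mono-< f≤g {xs = _ ∷ xs} (here refl) lt = ℕ.+-mono-<-≤ lt (sum-map-mono-≤ f≤g xs)
  sum-map-mono-< f≤g {xs = x ∷ _} (there y∈xs) lt = ℕ.+-mono-≤-< (f≤g x) (sum-map-mono-< f≤g y∈xs lt)

perimeter-∷-≤ : ∀ {S t} i → t ∈ S → nbr t i ∉ S → perimeter (nbr t i ∷ S) ≤ ℕ.suc (perimeter S)
perimeter-∷-≤ {S} {t} i t∈S new∉S =
  ℕ.≤-trans (ℕ.+-monoˡ-≤ _ (bndTile≤2 (nbr t i) i (there back∈S))) (ℕ.s≤s others<)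
  where
  back∈S : nbr (nbr t i) i ∈ S
  back∈S rewrite nbr-involutive t i = t∈S
  others< : sum (map (bndTile (nbr t i ∷ S)) S) ℕ.< perimeter S
  others< = sum-map-mono-< (bndTile-∷-≤ (nbr t i) S) t∈S (bndTile-∷-< i new∉S)

Reach-∷⁺ : ∀ {u S a b} → Reach S a b → Reach (u ∷ S) a b
Reach-∷⁺ here = here
Reach-∷⁺ (step i m r) = step i (there m) (Reach-∷⁺ r)

Reach-trans : ∀ {S a b c} → Reach S a b → Reach S b c → Reach S a c
Reach-trans here r = r
Reach-trans (step i m r) r′ = step i m (Reach-trans r r′)

Reach-adjacent : ∀ {S t u} i → nbr t i ≡ u → u ∈ S → Reach S t u
Reach-adjacent i refl u∈S = step i u∈S here

∷-isPolyiamond : ∀ {S t} i → IsPolyiamond S → t ∈ S → nbr t i ∉ S → IsPolyiamond (nbr t i ∷ S)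
∷-isPolyiamond {S} {t} i P t∈S new∉S = record
  { nonempty = λ ()
  ; distinct = ¬Any⇒All¬ S new∉S ∷ IsPolyiamond.distinct P
  ; connected = connected
  }
  where
  connected : ∀ {a b} → a ∈ nbr t i ∷ S → b ∈ nbr t i ∷ S → Reach (nbr t i ∷ S) a b
  connected (here refl) (here refl) = here
  connected (here refl) (there b∈S) =
    Reach-trans (Reach-adjacent i (nbr-involutive t i) (there t∈S))
                (Reach-∷⁺ (IsPolyiamond.connected P t∈S b∈S))
  connected (there a∈S) (here refl) =
    Reach-trans (Reach-∷⁺ (IsPolyiamond.connected P a∈S t∈S)) (Reach-adjacent i refl (here refl))
  connected (there a∈S) (there b∈S) = Reach-∷⁺ (IsPolyiamond.connected P a∈S b∈S)

level : Tile → ℤ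
level (tile _ y up) = y ℤ.+ y
level (tile _ y down) = + 1 ℤ.+ (y ℤ.+ y)

upEdge : Tile → Fin 3
upEdge (tile _ _ up) = zero
upEdge (tile _ _ down) = suc zero

level-upEdge : ∀ t → level (nbr t (upEdge t)) ≡ ℤ.suc (level t)
level-upEdge (tile x y up) = refl
level-upEdge (tile x y down) = [i+1]+[i+1]≡2+[i+i] y
  where
  [i+1]+[i+1]≡2+[i+i] : ∀ i → (i ℤ.+ + 1) ℤ.+ (i ℤ.+ + 1) ≡ + 1 ℤ.+ (+ 1 ℤ.+ (i ℤ.+ i))
  [i+1]+[i+1]≡2+[i+i] = solve-∀

module _ (a : Tile) (L : List Tile) where
  open Extrema ℤ.≤-totalOrder using (argmax; argmax-sel; f[⊥]≤f[argmax]; f[xs]≤f[argmax])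

  highest : Tile
  highest = argmax level a L

  highest-∈ : highest ∈ a ∷ L
  highest-∈ with argmax-sel level a L
  ... | inj₁ eq = here eq
  ... | inj₂ m = there m

  level≤level-highest : ∀ {s} → s ∈ a ∷ L → level s ℤ.≤ level highest
  level≤level-highest (here refl) = f[⊥]≤f[argmax] {f = level} a L
  level≤level-highest (there s∈L) = All.lookup (f[xs]≤f[argmax] {f = level} a L) s∈L

  above-highest-∉ : nbr highest (upEdge highest) ∉ a ∷ L
  above-highest-∉ above∈ = ℤ.<-irrefl refl (ℤ.suc[i]≤j⇒i<j
    (subst (ℤ._≤ level highest) (level-upEdge highest) (level≤level-highest above∈)))

grow : ∀ {S} → IsPolyiamond S →
       ∃ λ S′ → IsPolyiamond S′ × length S′ ≡ ℕ.suc (length S) × perimeter S′ ≤ ℕ.suc (perimeter S)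
grow {[]} P = ⊥-elim (IsPolyiamond.nonempty P refl)
grow {a ∷ L} P =
  nbr t (upEdge t) ∷ a ∷ L ,
  ∷-isPolyiamond (upEdge t) P (highest-∈ a L) (above-highest-∉ a L) ,
  refl ,
  perimeter-∷-≤ (upEdge t) (highest-∈ a L) (above-highest-∉ a L)
  where
  t = highest a L

grow-by : ∀ d {S} → IsPolyiamond S →
          ∃ λ S′ → IsPolyiamond S′ × length S′ ≡ d + length S × perimeter S′ ≤ d + perimeter S
grow-by ℕ.zero P = _ , P , refl , ℕ.≤-refl
grow-by (ℕ.suc d) P with grow-by d P
... | S₁ , P₁ , len₁ , per₁ with grow P₁
... | S₂ , P₂ , len₂ , per₂ = S₂ , P₂ , trans len₂ (cong ℕ.suc len₁) , ℕ.≤-trans per₂ (ℕ.s≤s per₁)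

IsPMin-+-≤ : ∀ {d k p q} → IsPMin k p → IsPMin (d + k) q → q ≤ d + p
IsPMin-+-≤ {d} ((S , P , refl , refl) , _) (_ , minimal) with grow-by d P
... | S′ , P′ , len , per = ℕ.≤-trans (minimal S′ P′ len) per

i-k≤j-l : ∀ {i j k l} → i ℤ.+ l ℤ.≤ j ℤ.+ k → i ℤ.- k ℤ.≤ j ℤ.- l
i-k≤j-l {i} {j} {k} {l} le = begin
  i ℤ.- k               ≡⟨ i-k≡[i+l]-[k+l] i k l ⟩
  (i ℤ.+ l) ℤ.- (k ℤ.+ l) ≤⟨ ℤ.+-monoˡ-≤ (ℤ.- (k ℤ.+ l)) le ⟩
  (j ℤ.+ k) ℤ.- (k ℤ.+ l) ≡⟨ [j+k]-[k+l]≡j-l j k l ⟩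
  j ℤ.- l               ∎
  where
  open ℤ.≤-Reasoning
  i-k≡[i+l]-[k+l] : ∀ i k l → i ℤ.- k ≡ (i ℤ.+ l) ℤ.- (k ℤ.+ l)
  i-k≡[i+l]-[k+l] = solve-∀
  [j+k]-[k+l]≡j-l : ∀ j k l → (j ℤ.+ k) ℤ.- (k ℤ.+ l) ≡ j ℤ.- l
  [j+k]-[k+l]≡j-l = solve-∀

/-monoˡ-≤ : ∀ {i j} k → i ℤ.≤ j → i ℚ./ ℕ.suc k ℚ.≤ j ℚ./ ℕ.suc k
/-monoˡ-≤ {i} {j} k i≤j = ℚ.toℚᵘ-cancel-≤ (begin
  ℚ.toℚᵘ (i ℚ./ ℕ.suc k) ≃⟨ ℚ.toℚᵘ-fromℚᵘ (mkℚᵘ i k) ⟩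
  mkℚᵘ i k              ≤⟨ *≤* (ℤ.*-monoʳ-≤-nonNeg (+ ℕ.suc k) i≤j) ⟩
  mkℚᵘ j k              ≃⟨ ℚᵘ.≃-sym (ℚ.toℚᵘ-fromℚᵘ (mkℚᵘ j k)) ⟩
  ℚ.toℚᵘ (j ℚ./ ℕ.suc k) ∎)
  where open ℚᵘ.≤-Reasoning

M-mono : ∀ n m p q → n + q ≤ m + p → M n p ℚ.≤ M m q
M-mono n m p q le = /-monoˡ-≤ 2 (i-k≤j-l {+ n ℤ.+ + 2} {+ m ℤ.+ + 2} {+ p} {+ q} (ℤ.+≤+ shifted))
  where
  shifted : n + 2 + q ≤ m + 2 + p
  shifted = subst₂ _≤_ (xy∙z≈xz∙y n q 2) (xy∙z≈xz∙y m p 2) (ℕ.+-monoˡ-≤ 2 le)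

lemma3 : (h n m p q : ℕ) → 1 ≤ n → n ≤ m →
         IsPMin (n + h) p → IsPMin (m + h) q →
         M n p ℚ.≤ M m q
lemma3 h n m p q _ n≤m pmin-p pmin-q = M-mono n m p q (begin
  n + q       ≤⟨ ℕ.+-monoʳ-≤ n (IsPMin-+-≤ pmin-p (subst (λ k → IsPMin k q) m+h≡d+[n+h] pmin-q)) ⟩
  n + (d + p) ≡⟨ x∙yz≈yx∙z n d p ⟩
  d + n + p   ≡⟨ cong (_+ p) (ℕ.m∸n+n≡m n≤m) ⟩
  m + p       ∎)
  where
  open ℕ.≤-Reasoning
  d = m ℕ.∸ n
  m+h≡d+[n+h] : m + h ≡ d + (n + h)
  m+h≡d+[n+h] = trans (cong (_+ h) (sym (ℕ.m∸n+n≡m n≤m))) (ℕ.+-assoc d n h)
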